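{- Let $n\ge1$ and $d$ be integers with $|d|\ge2$. Every element $\alpha\in\Sigma(n,d)$ is the class of an element $\sum_{v=1}^{n-1}\alpha_v\epsilon_v$ with rational coefficients satisfying $0\le\alpha_v<1$ for each $1\le v\le n-1$; and the order of $\alpha$ in $\Sigma(n,d)$ is the smallest positive integer $m$ such that $m\alpha_v\in\mathbb{Z}$ for all $1\le v\le n-1$.
   Context: In $\mathbb{Q}[x,x^{ -1}]/(x^n-1)$ (exponents mod $n$) put $e_v=x^v-1$, $\epsilon_v=d\,e_v-e_{dv}$; $\mathcal Z_n$ = $\mathbb{Z}$-span of $e_1,\dots,e_{n-1}$, $\mathcal E_{n,d}$ = $\mathbb{Z}$-span of $\epsilon_1,\dots,\epsilon_{n-1}$, and $\Sigma(n,d)=\mathcal Z_n/\mathcal E_{n,d}$. -}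

module Defs where

open import Data.Nat as ℕ using (ℕ; zero; suc; NonZero; _∸_; _≡ᵇ_)
open import Data.Integer as ℤ using (ℤ; +_; _%ℕ_)
open import Data.Rational as ℚ using (ℚ; 0ℚ; 1ℚ; _/_; _+_; _-_; _*_; _≤_; _<_)
open import Data.Fin using (Fin; toℕ)
open import Data.Bool using (if_then_else_)
open import Data.Product using (Σ; ∃; _×_)
open import Relation.Nullary using (¬_)
open import Relation.Binary.PropositionalEquality using (_≡_)

-- Elements of ℚ[x,x⁻¹]/(xⁿ-1) are represented by their coefficient vectors
-- w.r.t. the ℚ-basis x^0, …, x^{n-1}; equality is pointwise equality.
Elt : ℕ → Set
Elt n = Fin n → ℚ

ι : ℤ → ℚ
ι z = z / 1

-- x^z for an integer exponent z (exponents taken mod n)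
xpow : (n : ℕ) → .{{_ : NonZero n}} → ℤ → Elt n
xpow n z i = if toℕ i ≡ᵇ (z %ℕ n) then 1ℚ else 0ℚ

e : (n : ℕ) → .{{_ : NonZero n}} → ℤ → Elt n
e n v i = xpow n v i - xpow n (+ 0) i

ε : (n : ℕ) → .{{_ : NonZero n}} → ℤ → ℤ → Elt n
ε n d v i = ι d * e n v i - e n (d ℤ.* v) i

sumTo : (ℕ → ℚ) → ℕ → ℚ
sumTo f zero = 0ℚ
sumTo f (suc k) = sumTo f k + f (suc k)

lin : (n : ℕ) → (ℕ → ℚ) → (ℕ → Elt n) → Elt n
lin n a b i = sumTo (λ v → a v * b v i) (n ∸ 1)

zElt : (n : ℕ) → .{{_ : NonZero n}} → (ℕ → ℤ) → Elt n
zElt n c = lin n (λ v → ι (c v)) (λ v → e n (+ v))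

InE : (n : ℕ) → .{{_ : NonZero n}} → ℤ → Elt n → Set
InE n d y = ∃ λ (k : ℕ → ℤ) →
  ∀ i → y i ≡ lin n (λ v → ι (k v)) (λ v → ε n d (+ v)) i

scale : {n : ℕ} → ℚ → Elt n → Elt n
scale q y i = q * y i

diff : {n : ℕ} → Elt n → Elt n → Elt n
diff y z i = y i - z i

-- m is the order of the class of Σ c_v e_v in Σ(n,d) = 𝒵_n / ℰ_{n,d}
IsOrderΣ : (n : ℕ) → .{{_ : NonZero n}} → ℤ → (ℕ → ℤ) → ℕ → Set
IsOrderΣ n d c m =
  (0 ℕ.< m) × InE n d (scale (ι (+ m)) (zElt n c)) ×
  (∀ k → 0 ℕ.< k → k ℕ.< m → ¬ InE n d (scale (ι (+ k)) (zElt n c)))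

IsInt : ℚ → Set
IsInt q = ∃ λ (z : ℤ) → q ≡ ι z

AllInt : ℕ → (ℕ → ℚ) → ℕ → Set
AllInt n α m = ∀ v → 1 ℕ.≤ v → v ℕ.≤ n ∸ 1 → IsInt (ι (+ m) * α v)

IsLeastDenom : ℕ → (ℕ → ℚ) → ℕ → Set
IsLeastDenom n α m =
  (0 ℕ.< m) × AllInt n α m × (∀ k → 0 ℕ.< k → k ℕ.< m → ¬ AllInt n α k)

module Submission where

-- Let φ be the ring
-- endomorphism x ↦ x^d, so that e_v = x^v − 1 and ε_v = (d − φ) e_v.
--
-- 1. Linear algebra (module LinearAlgebra): if a linear operator φ satisfies
--    φᴵ = φᴶ and δᴵ ≠ δᴶ, then δ − φ is injective and surjective; an explicit
--    preimage of w is built from the telescoping sums Σ_t δ^{k-1-t} φᵗ w.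
-- 2. φ is the push-forward along multiplication by d on ℤ/n; since ℤ/n is
--    finite, d^I ≡ d^J (mod n) for some I < J, hence φᴵ = φᴶ, while
--    |d| ≥ 2 makes the powers of d distinct.
-- 3. The vectors with coefficient sum 0 are exactly the Σ_v a_v e_v, and
--    d − φ preserves this subspace; so ε_1, …, ε_{n-1} form a ℚ-basis of it
--    (module EpsilonBasis).  In particular Σ c_v e_v = Σ β_v ε_v for unique
--    rational β.
-- 4. With κ_v = ⌊β_v⌋ and α_v = β_v − κ_v ∈ [0,1), the difference
--    Σ c_v e_v − Σ α_v ε_v = Σ κ_v ε_v lies in ℰ_{n,d}; and by uniqueness of
--    ε-coordinates, k kills the class iff every k β_v, equivalently every
--    k α_v, is an integer.  The order statement follows (ReducedCoordinates).

open import Defs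
open import Data.Nat as ℕ using (ℕ; zero; suc; NonZero; _∸_; _≡ᵇ_)
import Data.Nat.Properties as ℕP
import Data.Nat.DivMod as ℕD
import Data.Nat.Divisibility as ℕ∣
open import Data.Integer as ℤ using (ℤ; +_; ∣_∣; _%ℕ_; _/ℕ_)
import Data.Integer.Properties as ℤP
import Data.Integer.DivMod as ℤD
import Data.Integer.Divisibility.Signed as ℤ∣
import Data.Integer.Solver
open import Data.Rational as ℚ using (ℚ; mkℚ; 0ℚ; 1ℚ; _≤_; _<_; _+_; _*_; _-_; -_; ↥_; ↧ₙ_; toℚᵘ)
import Data.Rational.Properties as ℚP
open import Data.Rational.Unnormalised as ℚᵘ using (mkℚᵘ; *≡*; *≤*; *<*)
import Data.Rational.Unnormalised.Properties as ℚᵘP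
open import Data.Rational.Solver using (module +-*-Solver)
open import Data.Fin as Fin using (Fin; zero; suc; toℕ)
import Data.Fin.Properties as FinP
open import Data.Bool using (if_then_else_)
open import Data.Product using (∃; _×_; _,_; proj₁; proj₂)
open import Data.Sum using (_⊎_; inj₁; inj₂)
open import Algebra.Bundles using (CommutativeRing)
open import Algebra.Definitions.RawSemiring ℚ.+-*-rawSemiring using (_^_)
open import Algebra.Properties.Group (CommutativeRing.+-group ℚP.+-*-commutativeRing)
  using (x∙y⁻¹≈ε⇒x≈y)
open import Algebra.Properties.Semiring.Sum (CommutativeRing.semiring ℚP.+-*-commutativeRing)
  using (sum-syntax; sum-cong-≗; sum-replicate-zero; sum-init-last; ∑-comm; ∑-distrib-+;
         *-distribˡ-sum; *-distribʳ-sum)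
open import Function.Base using (_∘_)
open import Function.Bundles using (_⇔_; mk⇔; Equivalence)
open import Relation.Nullary using (¬_)
open import Relation.Binary.PropositionalEquality hiding ([_]; J)
open +-*-Solver
module ZS = Data.Integer.Solver.+-*-Solver

-- The normalised fraction z / (k+1) represents the unnormalised one; passing to
-- unnormalised fractions shows that ι is an injective ring homomorphism ℤ → ℚ.
toℚᵘ-/ : ∀ z k → toℚᵘ (z ℚ./ suc k) ℚᵘ.≃ mkℚᵘ z k
toℚᵘ-/ z k = ℚP.toℚᵘ-fromℚᵘ (mkℚᵘ z k)

ι-+ : ∀ a b → ι (a ℤ.+ b) ≡ ι a + ι b
ι-+ a b = ℚP.toℚᵘ-injective (ℚᵘP.≃-trans (toℚᵘ-/ (a ℤ.+ b) 0) (ℚᵘP.≃-sym (ℚᵘP.≃-trans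
  (ℚP.toℚᵘ-homo-+ (ι a) (ι b)) (ℚᵘP.≃-trans (ℚᵘP.+-cong (toℚᵘ-/ a 0) (toℚᵘ-/ b 0)) (*≡* eq)))))
  where
  eq : (a ℤ.* + 1 ℤ.+ b ℤ.* + 1) ℤ.* + 1 ≡ (a ℤ.+ b) ℤ.* + 1
  eq = trans (ℤP.*-identityʳ _) (trans (cong₂ ℤ._+_ (ℤP.*-identityʳ a) (ℤP.*-identityʳ b))
         (sym (ℤP.*-identityʳ _)))

ι-* : ∀ a b → ι (a ℤ.* b) ≡ ι a * ι b
ι-* a b = ℚP.toℚᵘ-injective (ℚᵘP.≃-trans (toℚᵘ-/ (a ℤ.* b) 0) (ℚᵘP.≃-sym (ℚᵘP.≃-trans
  (ℚP.toℚᵘ-homo-* (ι a) (ι b)) (ℚᵘP.≃-trans (ℚᵘP.*-cong (toℚᵘ-/ a 0) (toℚᵘ-/ b 0)) (*≡* refl)))))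

ι-injective : ∀ {a b} → ι a ≡ ι b → a ≡ b
ι-injective {a} {b} eq
  with ℚᵘP.≃-trans (ℚᵘP.≃-sym (toℚᵘ-/ a 0)) (ℚᵘP.≃-trans (ℚP.toℚᵘ-cong eq) (toℚᵘ-/ b 0))
... | *≡* a*1≡b*1 = trans (sym (ℤP.*-identityʳ a)) (trans a*1≡b*1 (ℤP.*-identityʳ b))

ι-- : ∀ a b → ι (a ℤ.- b) ≡ ι a - ι b
ι-- a b = trans (ι-+ a (ℤ.- b)) (cong (_+_ (ι a)) ι-neg)
  where
  ι-neg : ι (ℤ.- b) ≡ - ι b
  ι-neg = ℚP.toℚᵘ-injective (ℚᵘP.≃-trans (toℚᵘ-/ (ℤ.- b) 0) (ℚᵘP.≃-sym
    (ℚᵘP.≃-trans (ℚP.toℚᵘ-homo‿- (ι b)) (ℚᵘP.-‿cong (toℚᵘ-/ b 0)))))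

⌊_⌋ : ℚ → ℤ
⌊ q ⌋ = ↥ q /ℕ ↧ₙ q

frac : ℚ → ℚ
frac q = + (↥ q %ℕ ↧ₙ q) ℚ./ ↧ₙ q

⌊⌋+frac : ∀ q → ι ⌊ q ⌋ + frac q ≡ q
⌊⌋+frac q@(mkℚ a b-1 _) = ℚP.toℚᵘ-injective (ℚᵘP.≃-trans (ℚP.toℚᵘ-homo-+ (ι ⌊ q ⌋) (frac q))
  (ℚᵘP.≃-trans (ℚᵘP.+-cong (toℚᵘ-/ ⌊ q ⌋ 0) (toℚᵘ-/ (+ r) b-1)) (*≡* eq)))
  where
  open ≡-Reasoning
  b = suc b-1
  r = a %ℕ b
  eq : (⌊ q ⌋ ℤ.* + b ℤ.+ + r ℤ.* + 1) ℤ.* + b ≡ a ℤ.* (+ 1 ℤ.* + b)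
  eq = begin
    (⌊ q ⌋ ℤ.* + b ℤ.+ + r ℤ.* + 1) ℤ.* + b
      ≡⟨ ZS.solve 3 (λ f r b → (f ZS.:* b ZS.:+ r ZS.:* ZS.con (+ 1)) ZS.:* b
                          ZS.:= (r ZS.:+ f ZS.:* b) ZS.:* (ZS.con (+ 1) ZS.:* b)) refl ⌊ q ⌋ (+ r) (+ b) ⟩
    (+ r ℤ.+ ⌊ q ⌋ ℤ.* + b) ℤ.* (+ 1 ℤ.* + b)
      ≡⟨ cong (ℤ._* (+ 1 ℤ.* + b)) (sym (ℤD.a≡a%ℕn+[a/ℕn]*n a b)) ⟩
    a ℤ.* (+ 1 ℤ.* + b) ∎

frac-nonneg : ∀ q → 0ℚ ≤ frac q
frac-nonneg q@(mkℚ a b-1 _) = ℚP.toℚᵘ-cancel-≤ (ℚᵘP.≤-respʳ-≃ (ℚᵘP.≃-sym (toℚᵘ-/ (+ (a %ℕ suc b-1)) b-1))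
  (*≤* (subst (ℤ._≤_ (+ 0)) (sym (ℤP.*-identityʳ (+ (a %ℕ suc b-1)))) (ℤ.+≤+ ℕ.z≤n))))

frac<1 : ∀ q → frac q < 1ℚ
frac<1 q@(mkℚ a b-1 _) = ℚP.toℚᵘ-cancel-< (ℚᵘP.<-respˡ-≃ (ℚᵘP.≃-sym (toℚᵘ-/ (+ r) b-1))
  (*<* (subst₂ ℤ._<_ (sym (ℤP.*-identityʳ (+ r))) (sym (ℤP.*-identityˡ (+ suc b-1)))
    (ℤ.+<+ (ℤD.n%ℕd<d a (suc b-1))))))
  where r = a %ℕ suc b-1

integer-in-unit-interval : ∀ w → 0ℚ ≤ ι w → ι w < 1ℚ → w ≡ + 0
integer-in-unit-interval w 0≤w w<1 = go w (ℚᵘP.≤-respʳ-≃ (toℚᵘ-/ w 0) (ℚP.toℚᵘ-mono-≤ 0≤w))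
                          (ℚᵘP.<-respˡ-≃ (toℚᵘ-/ w 0) (ℚP.toℚᵘ-mono-< w<1))
  where
  go : ∀ w → ℚᵘ.0ℚᵘ ℚᵘ.≤ mkℚᵘ w 0 → mkℚᵘ w 0 ℚᵘ.< ℚᵘ.1ℚᵘ → w ≡ + 0
  go (+ zero) _ _ = refl
  go (+ suc k) _ (*<* (ℤ.+<+ (ℕ.s≤s ())))
  go ℤ.-[1+ k ] (*≤* ()) _

-- The fractional part of an integer vanishes, so its floor recovers it.
⌊⌋-integer : ∀ q → IsInt q → ι ⌊ q ⌋ ≡ q
⌊⌋-integer q (z , q≡z) = begin
  ι ⌊ q ⌋                      ≡⟨ solve 2 (λ f r → f := (f :+ r) :- r) refl (ι ⌊ q ⌋) (frac q) ⟩
  (ι ⌊ q ⌋ + frac q) - frac q  ≡⟨ cong₂ _-_ (⌊⌋+frac q) frac≡0 ⟩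
  q - 0ℚ                       ≡⟨ ℚP.+-identityʳ q ⟩
  q                            ∎
  where
  open ≡-Reasoning
  frac≡ι : frac q ≡ ι (z ℤ.- ⌊ q ⌋)
  frac≡ι = begin
    frac q                       ≡⟨ solve 2 (λ f r → r := (f :+ r) :- f) refl (ι ⌊ q ⌋) (frac q) ⟩
    (ι ⌊ q ⌋ + frac q) - ι ⌊ q ⌋ ≡⟨ cong (_- ι ⌊ q ⌋) (trans (⌊⌋+frac q) q≡z) ⟩
    ι z - ι ⌊ q ⌋                ≡⟨ sym (ι-- z ⌊ q ⌋) ⟩
    ι (z ℤ.- ⌊ q ⌋)              ∎
  frac≡0 : frac q ≡ 0ℚ
  frac≡0 = trans frac≡ι (cong ι (integer-in-unit-interval (z ℤ.- ⌊ q ⌋)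
    (subst (0ℚ ≤_) frac≡ι (frac-nonneg q)) (subst (_< 1ℚ) frac≡ι (frac<1 q))))

*-cancel-nonzero : ∀ c x → ¬ c ≡ 0ℚ → c * x ≡ 0ℚ → x ≡ 0ℚ
*-cancel-nonzero c x c≢0 cx≡0 = begin
  x                 ≡⟨ ℚP.*-identityˡ x ⟨
  1ℚ * x            ≡⟨ cong (_* x) (ℚP.*-inverseˡ c) ⟨
  (ℚ.1/ c * c) * x  ≡⟨ ℚP.*-assoc (ℚ.1/ c) c x ⟩
  ℚ.1/ c * (c * x)  ≡⟨ cong (ℚ.1/ c *_) cx≡0 ⟩
  ℚ.1/ c * 0ℚ       ≡⟨ ℚP.*-zeroʳ (ℚ.1/ c) ⟩
  0ℚ                ∎
  where
  open ≡-Reasoning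
  instance _ = ℚ.≢-nonZero c≢0

ι-^ : ∀ z k → ι (z ℤ.^ k) ≡ ι z ^ k
ι-^ z zero    = refl
ι-^ z (suc k) = trans (ι-* z (z ℤ.^ k)) (cong (ι z *_) (ι-^ z k))

∣^∣ : ∀ z k → ∣ z ℤ.^ k ∣ ≡ ∣ z ∣ ℕ.^ k
∣^∣ z zero    = refl
∣^∣ z (suc k) = trans (ℤP.abs-* z (z ℤ.^ k)) (cong (∣ z ∣ ℕ.*_) (∣^∣ z k))

powers-distinct : ∀ d → 2 ℕ.≤ ∣ d ∣ → ∀ {I J} → I ℕ.< J → ¬ ι d ^ J - ι d ^ I ≡ 0ℚ
powers-distinct d 2≤∣d∣ {I} {J} I<J dᴶ-dᴵ≡0 = ℕP.<⇒≢ (ℕP.^-monoʳ-< ∣ d ∣ 2≤∣d∣ I<J) (begin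
  ∣ d ∣ ℕ.^ I    ≡⟨ ∣^∣ d I ⟨
  ∣ d ℤ.^ I ∣    ≡⟨ cong ∣_∣ (ι-injective {d ℤ.^ I} {d ℤ.^ J} (begin
                      ι (d ℤ.^ I)  ≡⟨ ι-^ d I ⟩
                      ι d ^ I      ≡⟨ x∙y⁻¹≈ε⇒x≈y (ι d ^ J) (ι d ^ I) dᴶ-dᴵ≡0 ⟨
                      ι d ^ J      ≡⟨ ι-^ d J ⟨
                      ι (d ℤ.^ J)  ∎)) ⟩
  ∣ d ℤ.^ J ∣    ≡⟨ ∣^∣ d J ⟩
  ∣ d ∣ ℕ.^ J    ∎)
  where open ≡-Reasoning

module LinearAlgebra {X : Set} where

  infixl 6 _⊕_ _⊖_
  infixl 7 _·_

  _⊕_ _⊖_ : (X → ℚ) → (X → ℚ) → (X → ℚ)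
  (y ⊕ z) x = y x + z x
  (y ⊖ z) x = y x - z x

  _·_ : ℚ → (X → ℚ) → (X → ℚ)
  (c · y) x = c * y x

  𝟘 : X → ℚ
  𝟘 _ = 0ℚ

  Endo : Set
  Endo = (X → ℚ) → (X → ℚ)

  record IsLinear (φ : Endo) : Set where
    field
      cong-≗ : ∀ {y z} → y ≗ z → φ y ≗ φ z
      ⊕-hom  : ∀ y z → φ (y ⊕ z) ≗ φ y ⊕ φ z
      ·-hom  : ∀ c y → φ (c · y) ≗ c · φ y

    ⊖-hom : ∀ y z → φ (y ⊖ z) ≗ φ y ⊖ φ z
    ⊖-hom y z x = begin
      φ (y ⊖ z) x
        ≡⟨ cong-≗ (λ x′ → solve 2 (λ a b → a :- b := a :+ (:- con 1ℚ) :* b) refl (y x′) (z x′)) x ⟩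
      φ (y ⊕ (- 1ℚ) · z) x      ≡⟨ ⊕-hom y ((- 1ℚ) · z) x ⟩
      φ y x + φ ((- 1ℚ) · z) x  ≡⟨ cong (_+_ (φ y x)) (·-hom (- 1ℚ) z x) ⟩
      φ y x + (- 1ℚ) * φ z x    ≡⟨ solve 2 (λ a b → a :+ (:- con 1ℚ) :* b := a :- b) refl (φ y x) (φ z x) ⟩
      φ y x - φ z x             ∎
      where open ≡-Reasoning

    𝟘-hom : φ 𝟘 ≗ 𝟘
    𝟘-hom x = begin
      φ 𝟘 x          ≡⟨ cong-≗ (λ _ → sym (ℚP.*-zeroˡ 0ℚ)) x ⟩
      φ (0ℚ · 𝟘) x   ≡⟨ ·-hom 0ℚ 𝟘 x ⟩
      0ℚ * φ 𝟘 x     ≡⟨ ℚP.*-zeroˡ (φ 𝟘 x) ⟩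
      0ℚ             ∎
      where open ≡-Reasoning

  sum-hom : ∀ {φ} → IsLinear φ → ∀ {k} (g : Fin k → X → ℚ) →
    φ (λ x → ∑[ i < k ] g i x) ≗ (λ x → ∑[ i < k ] φ (g i) x)
  sum-hom lin {zero}  g = IsLinear.𝟘-hom lin
  sum-hom {φ} lin {suc k} g x = begin
    φ (g zero ⊕ (λ x′ → ∑[ i < k ] g (suc i) x′)) x
      ≡⟨ IsLinear.⊕-hom lin (g zero) _ x ⟩
    φ (g zero) x + φ (λ x′ → ∑[ i < k ] g (suc i) x′) x
      ≡⟨ cong (_+_ (φ (g zero) x)) (sum-hom lin (g ∘ suc) x) ⟩
    φ (g zero) x + ∑[ i < k ] φ (g (suc i)) x ∎
    where open ≡-Reasoning

  iter : Endo → ℕ → Endo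
  iter φ zero    y = y
  iter φ (suc k) y = φ (iter φ k y)

  record EventuallyPeriodic (φ : Endo) : Set where
    field
      I J      : ℕ
      I<J      : I ℕ.< J
      periodic : ∀ y → iter φ I y ≗ iter φ J y

  Δ : ℚ → Endo → Endo
  Δ δ φ y = δ · y ⊖ φ y

  Δ-linear : ∀ {φ} δ → IsLinear φ → IsLinear (Δ δ φ)
  Δ-linear {φ} δ lin = record
    { cong-≗ = λ y≗z x → cong₂ (λ a b → δ * a - b) (y≗z x) (IsLinear.cong-≗ lin y≗z x)
    ; ⊕-hom  = λ y z x → trans (cong (_-_ (δ * (y x + z x))) (IsLinear.⊕-hom lin y z x))
        (solve 5 (λ d a b p q → d :* (a :+ b) :- (p :+ q) := (d :* a :- p) :+ (d :* b :- q))
           refl δ (y x) (z x) (φ y x) (φ z x))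
    ; ·-hom  = λ c y x → trans (cong (_-_ (δ * (c * y x))) (IsLinear.·-hom lin c y x))
        (solve 4 (λ d c a p → d :* (c :* a) :- c :* p := c :* (d :* a :- p)) refl δ c (y x) (φ y x))
    }

  eigen-iter : ∀ {φ δ y} → IsLinear φ → φ y ≗ δ · y → ∀ k → iter φ k y ≗ (δ ^ k) · y
  eigen-iter         lin φy zero    x = sym (ℚP.*-identityˡ _)
  eigen-iter {φ} {δ} {y} lin φy (suc k) x = begin
    φ (iter φ k y) x     ≡⟨ IsLinear.cong-≗ lin (eigen-iter lin φy k) x ⟩
    φ ((δ ^ k) · y) x    ≡⟨ IsLinear.·-hom lin (δ ^ k) y x ⟩
    δ ^ k * φ y x        ≡⟨ cong (δ ^ k *_) (φy x) ⟩
    δ ^ k * (δ * y x)    ≡⟨ solve 3 (λ p d a → p :* (d :* a) := (d :* p) :* a) refl (δ ^ k) δ (y x) ⟩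
    δ * δ ^ k * y x      ∎
    where open ≡-Reasoning

  -- Partial geometric sums Sₖ w = Σ_{t<k} δ^{k-1-t} φᵗ w.  They telescope:
  -- (δ − φ) Sₖ w = δᵏ w − φᵏ w.
  geometric : ℚ → Endo → ℕ → Endo
  geometric δ φ zero    w = 𝟘
  geometric δ φ (suc k) w = δ · geometric δ φ k w ⊕ iter φ k w

  telescope : ∀ {φ} δ → IsLinear φ → ∀ k w →
    Δ δ φ (geometric δ φ k w) ≗ (δ ^ k) · w ⊖ iter φ k w
  telescope {φ} δ lin zero w x = begin
    δ * 0ℚ - φ 𝟘 x   ≡⟨ cong₂ _-_ (ℚP.*-zeroʳ δ) (IsLinear.𝟘-hom lin x) ⟩
    0ℚ - 0ℚ          ≡⟨ solve 1 (λ a → con 0ℚ :- con 0ℚ := con 1ℚ :* a :- a) refl (w x) ⟩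
    1ℚ * w x - w x   ∎
    where open ≡-Reasoning
  telescope {φ} δ lin (suc k) w x = begin
    δ * (δ * S x + P x) - φ (δ · S ⊕ P) x
      ≡⟨ cong (_-_ (δ * (δ * S x + P x))) (trans (IsLinear.⊕-hom lin (δ · S) P x)
           (cong (_+ φ P x) (IsLinear.·-hom lin δ S x))) ⟩
    δ * (δ * S x + P x) - (δ * φ S x + φ P x)
      ≡⟨ solve 5 (λ d s p f q → d :* (d :* s :+ p) :- (d :* f :+ q) := d :* (d :* s :- f) :+ d :* p :- q)
           refl δ (S x) (P x) (φ S x) (φ P x) ⟩
    δ * (δ * S x - φ S x) + δ * P x - φ P x
      ≡⟨ cong (λ t → δ * t + δ * P x - φ P x) (telescope δ lin k w x) ⟩
    δ * (δ ^ k * w x - P x) + δ * P x - φ P x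
      ≡⟨ solve 5 (λ d e a p q → d :* (e :* a :- p) :+ d :* p :- q := (d :* e) :* a :- q)
           refl δ (δ ^ k) (w x) (P x) (φ P x) ⟩
    δ * δ ^ k * w x - φ P x ∎
    where
    open ≡-Reasoning
    S = geometric δ φ k w
    P = iter φ k w

  module Invertible {φ : Endo} (lin : IsLinear φ) (per : EventuallyPeriodic φ) (δ : ℚ)
    (δᴶ≢δᴵ : ¬ δ ^ EventuallyPeriodic.J per - δ ^ EventuallyPeriodic.I per ≡ 0ℚ) where

    open EventuallyPeriodic per

    -- δ is not an eigenvalue of φ, since (δᴶ − δᴵ) y = φᴶ y − φᴵ y = 0.
    no-eigenvector : ∀ {y} → φ y ≗ δ · y → y ≗ 𝟘
    no-eigenvector {y} φy x = *-cancel-nonzero (δ ^ J - δ ^ I) (y x) δᴶ≢δᴵ (begin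
      (δ ^ J - δ ^ I) * y x        ≡⟨ solve 3 (λ p q a → (p :- q) :* a := p :* a :- q :* a) refl (δ ^ J) (δ ^ I) (y x) ⟩
      δ ^ J * y x - δ ^ I * y x    ≡⟨ cong₂ _-_ (eigen-iter lin φy J x) (eigen-iter lin φy I x) ⟨
      iter φ J y x - iter φ I y x  ≡⟨ cong (_- iter φ I y x) (periodic y x) ⟨
      iter φ I y x - iter φ I y x  ≡⟨ ℚP.+-inverseʳ (iter φ I y x) ⟩
      0ℚ                           ∎)
      where open ≡-Reasoning

    Δ-injective : ∀ {y z} → Δ δ φ y ≗ Δ δ φ z → y ≗ z
    Δ-injective {y} {z} Δy≗Δz x = x∙y⁻¹≈ε⇒x≈y (y x) (z x) (no-eigenvector eigen x)
      where
      open ≡-Reasoning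
      eigen : φ (y ⊖ z) ≗ δ · (y ⊖ z)
      eigen x = begin
        φ (y ⊖ z) x
          ≡⟨ IsLinear.⊖-hom lin y z x ⟩
        φ y x - φ z x
          ≡⟨ solve 5 (λ d a b p q → p :- q := (d :* a :- d :* b) :- ((d :* a :- p) :- (d :* b :- q)))
               refl δ (y x) (z x) (φ y x) (φ z x) ⟩
        (δ * y x - δ * z x) - (Δ δ φ y x - Δ δ φ z x)
          ≡⟨ cong (λ t → (δ * y x - δ * z x) - (t - Δ δ φ z x)) (Δy≗Δz x) ⟩
        (δ * y x - δ * z x) - (Δ δ φ z x - Δ δ φ z x)
          ≡⟨ solve 4 (λ d a b t → (d :* a :- d :* b) :- (t :- t) := d :* (a :- b)) refl δ (y x) (z x) (Δ δ φ z x) ⟩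
        δ * (y x - z x) ∎

    -- The preimage of w is (Sᴶ w − Sᴵ w) / (δᴶ − δᴵ).
    Δ-surjective : ∀ w → ∃ λ y → Δ δ φ y ≗ w
    Δ-surjective w = y , solves
      where
      instance _ = ℚ.≢-nonZero δᴶ≢δᴵ
      c = δ ^ J - δ ^ I
      SJ = geometric δ φ J w
      SI = geometric δ φ I w
      y = ℚ.1/ c · (SJ ⊖ SI)
      open ≡-Reasoning
      solves : Δ δ φ y ≗ w
      solves x = begin
        δ * y x - φ y x
          ≡⟨ cong (_-_ (δ * y x)) (trans (IsLinear.·-hom lin (ℚ.1/ c) (SJ ⊖ SI) x)
               (cong (ℚ.1/ c *_) (IsLinear.⊖-hom lin SJ SI x))) ⟩
        δ * (ℚ.1/ c * (SJ x - SI x)) - ℚ.1/ c * (φ SJ x - φ SI x)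
          ≡⟨ solve 6 (λ d i a b p q → d :* (i :* (a :- b)) :- i :* (p :- q)
                                     := i :* ((d :* a :- p) :- (d :* b :- q)))
               refl δ (ℚ.1/ c) (SJ x) (SI x) (φ SJ x) (φ SI x) ⟩
        ℚ.1/ c * (Δ δ φ SJ x - Δ δ φ SI x)
          ≡⟨ cong (ℚ.1/ c *_) (cong₂ _-_ (telescope δ lin J w x) (telescope δ lin I w x)) ⟩
        ℚ.1/ c * ((δ ^ J * w x - iter φ J w x) - (δ ^ I * w x - iter φ I w x))
          ≡⟨ cong (λ t → ℚ.1/ c * ((δ ^ J * w x - t) - (δ ^ I * w x - iter φ I w x))) (periodic w x) ⟨
        ℚ.1/ c * ((δ ^ J * w x - iter φ I w x) - (δ ^ I * w x - iter φ I w x))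
          ≡⟨ solve 5 (λ i p q a t → i :* ((p :* a :- t) :- (q :* a :- t)) := (i :* (p :- q)) :* a)
               refl (ℚ.1/ c) (δ ^ J) (δ ^ I) (w x) (iter φ I w x) ⟩
        (ℚ.1/ c * c) * w x
          ≡⟨ cong (_* w x) (ℚP.*-inverseˡ c) ⟩
        1ℚ * w x
          ≡⟨ ℚP.*-identityˡ (w x) ⟩
        w x ∎

open LinearAlgebra

∑-distrib-- : ∀ {k} (f g : Fin k → ℚ) → ∑[ i < k ] (f i - g i) ≡ ∑[ i < k ] f i - ∑[ i < k ] g i
∑-distrib-- {zero}  f g = refl
∑-distrib-- {suc k} f g = begin
  (f zero - g zero) + ∑[ i < k ] (f (suc i) - g (suc i))
    ≡⟨ cong (_+_ (f zero - g zero)) (∑-distrib-- (f ∘ suc) (g ∘ suc)) ⟩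
  (f zero - g zero) + (∑[ i < k ] f (suc i) - ∑[ i < k ] g (suc i))
    ≡⟨ solve 4 (λ a b c d → (a :- b) :+ (c :- d) := (a :+ c) :- (b :+ d)) refl (f zero) (g zero) _ _ ⟩
  (f zero + ∑[ i < k ] f (suc i)) - (g zero + ∑[ i < k ] g (suc i)) ∎
  where open ≡-Reasoning

unit : ∀ {k} → Fin k → Fin k → ℚ
unit zero    zero    = 1ℚ
unit zero    (suc j) = 0ℚ
unit (suc i) zero    = 0ℚ
unit (suc i) (suc j) = unit i j

∑-unit : ∀ {k} (i : Fin k) (g : Fin k → ℚ) → ∑[ j < k ] (unit i j * g j) ≡ g i
∑-unit {suc k} zero g = begin
  1ℚ * g zero + ∑[ j < k ] (0ℚ * g (suc j))  ≡⟨ cong₂ _+_ (ℚP.*-identityˡ (g zero))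
                                                  (trans (sum-cong-≗ (λ j → ℚP.*-zeroˡ (g (suc j)))) (sum-replicate-zero k)) ⟩
  g zero + 0ℚ                               ≡⟨ ℚP.+-identityʳ (g zero) ⟩
  g zero                                    ∎
  where open ≡-Reasoning
∑-unit {suc k} (suc i) g = begin
  0ℚ * g zero + ∑[ j < k ] (unit i j * g (suc j)) ≡⟨ cong₂ _+_ (ℚP.*-zeroˡ (g zero)) (∑-unit i (g ∘ suc)) ⟩
  0ℚ + g (suc i)                                 ≡⟨ ℚP.+-identityˡ (g (suc i)) ⟩
  g (suc i)                                      ∎
  where open ≡-Reasoning

∑-unit-1 : ∀ {k} (i : Fin k) → ∑[ j < k ] unit i j ≡ 1ℚ
∑-unit-1 i = trans (sum-cong-≗ (λ j → sym (ℚP.*-identityʳ (unit i j)))) (∑-unit i (λ _ → 1ℚ))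

unit-sym : ∀ {k} (i j : Fin k) → unit i j ≡ unit j i
unit-sym zero    zero    = refl
unit-sym zero    (suc j) = refl
unit-sym (suc i) zero    = refl
unit-sym (suc i) (suc j) = unit-sym i j

push : ∀ {a b} → (Fin a → Fin b) → (Fin a → ℚ) → (Fin b → ℚ)
push {a} f y j = ∑[ u < a ] (y u * unit (f u) j)

push-unit : ∀ {a b} (f : Fin a → Fin b) i → push f (unit i) ≗ unit (f i)
push-unit f i j = ∑-unit i (λ u → unit (f u) j)

push-id : ∀ {a} (y : Fin a → ℚ) → push (λ u → u) y ≗ y
push-id y j = trans (sum-cong-≗ (λ u → trans (cong (y u *_) (unit-sym u j)) (ℚP.*-comm (y u) (unit j u))))
                    (∑-unit j y)

push-cong : ∀ {a b} {f g : Fin a → Fin b} → f ≗ g → ∀ y → push f y ≗ push g y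
push-cong f≗g y j = sum-cong-≗ (λ u → cong (λ k → y u * unit k j) (f≗g u))

push-∘ : ∀ {a b c} (g : Fin b → Fin c) (f : Fin a → Fin b) y → push g (push f y) ≗ push (g ∘ f) y
push-∘ {a} {b} g f y j = begin
  ∑[ w < b ] (∑[ u < a ] (y u * unit (f u) w) * unit (g w) j)
    ≡⟨ sum-cong-≗ (λ w → *-distribʳ-sum {a} (unit (g w) j) (λ u → y u * unit (f u) w)) ⟩
  ∑[ w < b ] ∑[ u < a ] (y u * unit (f u) w * unit (g w) j)
    ≡⟨ ∑-comm (λ w u → y u * unit (f u) w * unit (g w) j) ⟩
  ∑[ u < a ] ∑[ w < b ] (y u * unit (f u) w * unit (g w) j)
    ≡⟨ sum-cong-≗ (λ u → trans (sum-cong-≗ {b} (λ w → ℚP.*-assoc (y u) (unit (f u) w) (unit (g w) j)))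
                                (sym (*-distribˡ-sum {b} (y u) (λ w → unit (f u) w * unit (g w) j)))) ⟩
  ∑[ u < a ] (y u * ∑[ w < b ] (unit (f u) w * unit (g w) j))
    ≡⟨ sum-cong-≗ (λ u → cong (y u *_) (∑-unit (f u) (λ w → unit (g w) j))) ⟩
  ∑[ u < a ] (y u * unit (g (f u)) j) ∎
  where open ≡-Reasoning

∑-push : ∀ {a b} (f : Fin a → Fin b) y → ∑[ j < b ] push f y j ≡ ∑[ u < a ] y u
∑-push {a} {b} f y = begin
  ∑[ j < b ] ∑[ u < a ] (y u * unit (f u) j) ≡⟨ ∑-comm (λ j u → y u * unit (f u) j) ⟩
  ∑[ u < a ] ∑[ j < b ] (y u * unit (f u) j) ≡⟨ sum-cong-≗ (λ u → sym (*-distribˡ-sum {b} (y u) (unit (f u)))) ⟩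
  ∑[ u < a ] (y u * ∑[ j < b ] unit (f u) j) ≡⟨ sum-cong-≗ (λ u → trans (cong (y u *_) (∑-unit-1 (f u))) (ℚP.*-identityʳ (y u))) ⟩
  ∑[ u < a ] y u ∎
  where open ≡-Reasoning

push-linear : ∀ {a} (f : Fin a → Fin a) → IsLinear (push f)
push-linear {a} f = record
  { cong-≗ = λ y≗z j → sum-cong-≗ (λ u → cong (_* unit (f u) j) (y≗z u))
  ; ⊕-hom  = λ y z j → trans (sum-cong-≗ (λ u → ℚP.*-distribʳ-+ (unit (f u) j) (y u) (z u)))
                             (∑-distrib-+ (λ u → y u * unit (f u) j) (λ u → z u * unit (f u) j))
  ; ·-hom  = λ c y j → trans (sum-cong-≗ (λ u → ℚP.*-assoc c (y u) (unit (f u) j)))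
                             (sym (*-distribˡ-sum {a} c (λ u → y u * unit (f u) j)))
  }

module Residues (n : ℕ) .{{_ : NonZero n}} where

  [_] : ℤ → Fin n
  [ z ] = Fin.fromℕ< (ℤD.n%ℕd<d z n)

  toℕ-[] : ∀ z → toℕ [ z ] ≡ z %ℕ n
  toℕ-[] z = FinP.toℕ-fromℕ< (ℤD.n%ℕd<d z n)

  n∣z-residue : ∀ z → + n ℤ∣.∣ z ℤ.- + (z %ℕ n)
  n∣z-residue z = ℤ∣.divides (z /ℕ n) (begin
    z ℤ.- + (z %ℕ n)                            ≡⟨ cong (ℤ._- + (z %ℕ n)) (ℤD.a≡a%ℕn+[a/ℕn]*n z n) ⟩
    + (z %ℕ n) ℤ.+ (z /ℕ n) ℤ.* + n ℤ.- + (z %ℕ n) ≡⟨ ZS.solve 3 (λ r q m → r ZS.:+ q ZS.:* m ZS.:- r ZS.:= q ZS.:* m)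
                                                        refl (+ (z %ℕ n)) (z /ℕ n) (+ n) ⟩
    (z /ℕ n) ℤ.* + n                            ∎)
    where open ≡-Reasoning

  multiple-below : ∀ {x} → x ℕ.< n → n ℕ∣.∣ x → x ≡ 0
  multiple-below {x} x<n n∣x = trans (sym (ℕD.m<n⇒m%n≡m x<n)) (ℕ∣.n∣m⇒m%n≡0 x n n∣x)

  residue-unique-≤ : ∀ {a b} → a ℕ.≤ b → b ℕ.< n → n ℕ∣.∣ ∣ a ℤ.⊖ b ∣ → a ≡ b
  residue-unique-≤ {a} {b} a≤b b<n n∣ = ℕP.≤-antisym a≤b (ℕP.m∸n≡0⇒m≤n (multiple-below
    (ℕP.≤-<-trans (ℕP.m∸n≤m b a) b<n) (subst (n ℕ∣.∣_) (ℤP.∣⊖∣-≤ a≤b) n∣)))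

  residue-unique : ∀ {r r′} → r ℕ.< n → r′ ℕ.< n → + n ℤ∣.∣ + r ℤ.- + r′ → r ≡ r′
  residue-unique {r} {r′} r<n r′<n n∣r-r′ = by-order (ℕP.≤-total r r′)
    where
    n∣∣r⊖r′∣ : n ℕ∣.∣ ∣ r ℤ.⊖ r′ ∣
    n∣∣r⊖r′∣ = subst (n ℕ∣.∣_) (cong ∣_∣ (ℤP.[+m]-[+n]≡m⊖n r r′)) (ℤ∣.∣⇒∣ᵤ n∣r-r′)
    by-order : r ℕ.≤ r′ ⊎ r′ ℕ.≤ r → r ≡ r′
    by-order (inj₁ r≤r′) = residue-unique-≤ r≤r′ r′<n n∣∣r⊖r′∣
    by-order (inj₂ r′≤r) =
      sym (residue-unique-≤ r′≤r r<n (subst (n ℕ∣.∣_) (ℤP.∣m⊖n∣≡∣n⊖m∣ r r′) n∣∣r⊖r′∣))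

  []-cong : ∀ {a b} → + n ℤ∣.∣ a ℤ.- b → [ a ] ≡ [ b ]
  []-cong {a} {b} n∣a-b = FinP.toℕ-injective (trans (toℕ-[] a) (trans
    (residue-unique (ℤD.n%ℕd<d a n) (ℤD.n%ℕd<d b n) n∣ra-rb) (sym (toℕ-[] b))))
    where
    ra = + (a %ℕ n)
    rb = + (b %ℕ n)
    n∣ra-rb : + n ℤ∣.∣ ra ℤ.- rb
    n∣ra-rb = subst (+ n ℤ∣.∣_)
      (ZS.solve 4 (λ a b ra rb → ((a ZS.:- b) ZS.:- (a ZS.:- ra)) ZS.:+ (b ZS.:- rb) ZS.:= ra ZS.:- rb) refl a b ra rb)
      (ℤ∣.∣m∣n⇒∣m+n (ℤ∣.∣m∣n⇒∣m-n n∣a-b (n∣z-residue a)) (n∣z-residue b))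

  []-toℕ : ∀ k → [ + toℕ k ] ≡ k
  []-toℕ k = FinP.toℕ-injective (trans (toℕ-[] (+ toℕ k)) (ℕD.m<n⇒m%n≡m (FinP.toℕ<n k)))

  μ : ℤ → Fin n → Fin n
  μ z u = [ z ℤ.* + toℕ u ]

  μ-1 : ∀ u → μ (+ 1) u ≡ u
  μ-1 u = trans (cong [_] (ℤP.*-identityˡ (+ toℕ u))) ([]-toℕ u)

  μ-∘ : ∀ z w u → μ z (μ w u) ≡ μ (z ℤ.* w) u
  μ-∘ z w u = []-cong {z ℤ.* + toℕ (μ w u)} {z ℤ.* w ℤ.* + toℕ u}
    (subst (+ n ℤ∣.∣_) eq (ℤ∣.∣n⇒∣m*n (ℤ.- z) (n∣z-residue x)))
    where
    x = w ℤ.* + toℕ u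
    eq : ℤ.- z ℤ.* (x ℤ.- + (x %ℕ n)) ≡ z ℤ.* + toℕ (μ w u) ℤ.- z ℤ.* w ℤ.* + toℕ u
    eq = trans (ZS.solve 4 (λ z w u r → ZS.:- z ZS.:* (w ZS.:* u ZS.:- r) ZS.:= z ZS.:* r ZS.:- z ZS.:* w ZS.:* u)
                  refl z w (+ toℕ u) (+ (x %ℕ n)))
               (cong (λ r → z ℤ.* + r ℤ.- z ℤ.* w ℤ.* + toℕ u) (sym (toℕ-[] x)))

  μ-residue : ∀ {a b} → [ a ] ≡ [ b ] → ∀ u → μ a u ≡ μ b u
  μ-residue {a} {b} [a]≡[b] u = []-cong {a ℤ.* + toℕ u} {b ℤ.* + toℕ u}
    (subst (+ n ℤ∣.∣_) eq (ℤ∣.∣m⇒∣m*n (+ toℕ u) n∣a-b))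
    where
    n∣a-b : + n ℤ∣.∣ a ℤ.- b
    n∣a-b = subst (+ n ℤ∣.∣_)
      (ZS.solve 3 (λ a b r → (a ZS.:- r) ZS.:- (b ZS.:- r) ZS.:= a ZS.:- b) refl a b (+ (a %ℕ n)))
      (ℤ∣.∣m∣n⇒∣m-n (n∣z-residue a)
        (subst (λ r → + n ℤ∣.∣ b ℤ.- + r) (trans (sym (toℕ-[] b)) (trans (cong toℕ (sym [a]≡[b])) (toℕ-[] a)))
          (n∣z-residue b)))
    eq : (a ℤ.- b) ℤ.* + toℕ u ≡ a ℤ.* + toℕ u ℤ.- b ℤ.* + toℕ u
    eq = ZS.solve 3 (λ a b u → (a ZS.:- b) ZS.:* u ZS.:= a ZS.:* u ZS.:- b ZS.:* u) refl a b (+ toℕ u)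

≡ᵇ-unit : ∀ {k} (i j : Fin k) → (if toℕ i ≡ᵇ toℕ j then 1ℚ else 0ℚ) ≡ unit j i
≡ᵇ-unit zero    zero    = refl
≡ᵇ-unit zero    (suc j) = refl
≡ᵇ-unit (suc i) zero    = refl
≡ᵇ-unit (suc i) (suc j) = ≡ᵇ-unit i j

sumTo-∑ : ∀ k (f : ℕ → ℚ) → sumTo f k ≡ ∑[ i < k ] f (suc (toℕ i))
sumTo-∑ zero    f = refl
sumTo-∑ (suc k) f = sym (begin
  ∑[ i < suc k ] f (suc (toℕ i))
    ≡⟨ sum-init-last {k} (λ i → f (suc (toℕ i))) ⟩
  ∑[ i < k ] f (suc (toℕ (Fin.inject₁ i))) + f (suc (toℕ (Fin.fromℕ k)))
    ≡⟨ cong₂ _+_ (sum-cong-≗ {k} (λ i → cong (f ∘ suc) (FinP.toℕ-inject₁ i))) (cong (f ∘ suc) (FinP.toℕ-fromℕ k)) ⟩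
  ∑[ i < k ] f (suc (toℕ i)) + f (suc k)
    ≡⟨ cong (_+ f (suc k)) (sumTo-∑ k f) ⟨
  sumTo f k + f (suc k) ∎)
  where open ≡-Reasoning

lin-sub : ∀ n a a′ (b : ℕ → Elt n) j → lin n a b j - lin n a′ b j ≡ lin n (λ v → a v - a′ v) b j
lin-sub n a a′ b j = begin
  lin n a b j - lin n a′ b j
    ≡⟨ cong₂ _-_ (sumTo-∑ (n ∸ 1) (λ v → a v * b v j)) (sumTo-∑ (n ∸ 1) (λ v → a′ v * b v j)) ⟩
  ∑[ i < n ∸ 1 ] (a (v i) * b (v i) j) - ∑[ i < n ∸ 1 ] (a′ (v i) * b (v i) j)
    ≡⟨ ∑-distrib-- (λ i → a (v i) * b (v i) j) (λ i → a′ (v i) * b (v i) j) ⟨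
  ∑[ i < n ∸ 1 ] (a (v i) * b (v i) j - a′ (v i) * b (v i) j)
    ≡⟨ sum-cong-≗ (λ i → solve 3 (λ x y z → x :* z :- y :* z := (x :- y) :* z) refl (a (v i)) (a′ (v i)) (b (v i) j)) ⟩
  ∑[ i < n ∸ 1 ] ((a (v i) - a′ (v i)) * b (v i) j)
    ≡⟨ sumTo-∑ (n ∸ 1) (λ v → (a v - a′ v) * b v j) ⟨
  lin n (λ v → a v - a′ v) b j ∎
  where
  open ≡-Reasoning
  v : Fin (n ∸ 1) → ℕ
  v i = suc (toℕ i)

lin-scale : ∀ n q a (b : ℕ → Elt n) j → q * lin n a b j ≡ lin n (λ v → q * a v) b j
lin-scale n q a b j = begin
  q * lin n a b j
    ≡⟨ cong (q *_) (sumTo-∑ (n ∸ 1) (λ v → a v * b v j)) ⟩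
  q * ∑[ i < n ∸ 1 ] (a (suc (toℕ i)) * b (suc (toℕ i)) j)
    ≡⟨ *-distribˡ-sum {n ∸ 1} q (λ i → a (suc (toℕ i)) * b (suc (toℕ i)) j) ⟩
  ∑[ i < n ∸ 1 ] (q * (a (suc (toℕ i)) * b (suc (toℕ i)) j))
    ≡⟨ sum-cong-≗ {n ∸ 1} (λ i → ℚP.*-assoc q (a (suc (toℕ i))) (b (suc (toℕ i)) j)) ⟨
  ∑[ i < n ∸ 1 ] (q * a (suc (toℕ i)) * b (suc (toℕ i)) j)
    ≡⟨ sumTo-∑ (n ∸ 1) (λ v → q * a v * b v j) ⟨
  lin n (λ v → q * a v) b j ∎
  where open ≡-Reasoning

lin-cong : ∀ n {a a′} (b : ℕ → Elt n) → (∀ v → 1 ℕ.≤ v → v ℕ.≤ n ∸ 1 → a v ≡ a′ v) → ∀ j →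
  lin n a b j ≡ lin n a′ b j
lin-cong n {a} {a′} b a≡a′ j = trans (sumTo-∑ (n ∸ 1) (λ v → a v * b v j)) (trans
  (sum-cong-≗ (λ i → cong (_* b (suc (toℕ i)) j) (a≡a′ (suc (toℕ i)) (ℕ.s≤s ℕ.z≤n) (FinP.toℕ<n i))))
  (sym (sumTo-∑ (n ∸ 1) (λ v → a′ v * b v j))))

-- ℚ[x,x⁻¹]/(xⁿ − 1) for n = suc m: a vector y : Fin n → ℚ stands for
-- Σ_j y_j x^j, and φ is the ring endomorphism x ↦ x^d, i.e. x^v ↦ x^{dv}.
module GroupAlgebra (m : ℕ) (d : ℤ) where

  n : ℕ
  n = suc m

  open Residues n

  φ : Endo
  φ = push (μ d)

  φ-linear : IsLinear φ
  φ-linear = push-linear (μ d)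

  φ-iter : ∀ k y → iter φ k y ≗ push (μ (d ℤ.^ k)) y
  φ-iter zero    y j = sym (trans (push-cong μ-1 y j) (push-id y j))
  φ-iter (suc k) y j = begin
    φ (iter φ k y) j                   ≡⟨ IsLinear.cong-≗ φ-linear (φ-iter k y) j ⟩
    φ (push (μ (d ℤ.^ k)) y) j         ≡⟨ push-∘ (μ d) (μ (d ℤ.^ k)) y j ⟩
    push (μ d ∘ μ (d ℤ.^ k)) y j       ≡⟨ push-cong (μ-∘ d (d ℤ.^ k)) y j ⟩
    push (μ (d ℤ.^ suc k)) y j         ∎
    where open ≡-Reasoning

  -- The n + 1 residues of d⁰, …, dⁿ cannot all differ, so φ is eventually
  -- periodic.
  opaque
    φ-periodic : EventuallyPeriodic φ
    φ-periodic with FinP.pigeonhole (ℕP.n<1+n n) (λ (k : Fin (suc n)) → [ d ℤ.^ toℕ k ])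
    ... | i , j , i<j , [dⁱ]≡[dʲ] = record
      { I = toℕ i ; J = toℕ j ; I<J = i<j
      ; periodic = λ y x → begin
          iter φ (toℕ i) y x              ≡⟨ φ-iter (toℕ i) y x ⟩
          push (μ (d ℤ.^ toℕ i)) y x      ≡⟨ push-cong (μ-residue {d ℤ.^ toℕ i} {d ℤ.^ toℕ j} [dⁱ]≡[dʲ]) y x ⟩
          push (μ (d ℤ.^ toℕ j)) y x      ≡⟨ φ-iter (toℕ j) y x ⟨
          iter φ (toℕ j) y x              ∎
      }
      where open ≡-Reasoning

  xpow-unit : ∀ z → xpow n z ≗ unit [ z ]
  xpow-unit z i = trans (cong (λ r → if toℕ i ≡ᵇ r then 1ℚ else 0ℚ) (sym (toℕ-[] z))) (≡ᵇ-unit i [ z ])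

  eᶠ : Fin n → Elt n
  eᶠ k = unit k ⊖ unit zero

  e-eᶠ : ∀ k → e n (+ toℕ k) ≗ eᶠ k
  e-eᶠ k i = cong₂ _-_ (trans (xpow-unit (+ toℕ k) i) (cong (λ u → unit u i) ([]-toℕ k)))
                       (xpow-unit (+ 0) i)

  e-φ : ∀ k → e n (d ℤ.* + toℕ k) ≗ φ (eᶠ k)
  e-φ k i = begin
    xpow n (d ℤ.* + toℕ k) i - xpow n (+ 0) i
      ≡⟨ cong₂ _-_ (xpow-unit (d ℤ.* + toℕ k) i) (xpow-unit (+ 0) i) ⟩
    unit (μ d k) i - unit zero i
      ≡⟨ cong₂ _-_ (push-unit (μ d) k i) (trans (push-unit (μ d) zero i) (cong (λ u → unit u i) μd0≡0)) ⟨
    φ (unit k) i - φ (unit zero) i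
      ≡⟨ IsLinear.⊖-hom φ-linear (unit k) (unit zero) i ⟨
    φ (eᶠ k) i ∎
    where
    open ≡-Reasoning
    μd0≡0 : μ d zero ≡ zero
    μd0≡0 = trans (cong [_] (ℤP.*-zeroʳ d)) ([]-toℕ zero)

  ε-Δ : ∀ k → ε n d (+ toℕ k) ≗ Δ (ι d) φ (eᶠ k)
  ε-Δ k i = cong₂ (λ a b → ι d * a - b) (e-eᶠ k i) (e-φ k i)

  Z : (Fin m → ℚ) → Elt n
  Z a j = ∑[ i < m ] (a i * eᶠ (suc i) j)

  Z-cong : ∀ {a b} → a ≗ b → Z a ≗ Z b
  Z-cong a≗b j = sum-cong-≗ (λ i → cong (_* eᶠ (suc i) j) (a≗b i))

  Z-coordinate : ∀ a i → Z a (suc i) ≡ a i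
  Z-coordinate a i = trans (sum-cong-≗ (λ i′ → cong (a i′ *_) (ℚP.+-identityʳ (unit i′ i)))) (push-id a i)

  ∑-eᶠ : ∀ k → ∑[ j < n ] eᶠ k j ≡ 0ℚ
  ∑-eᶠ k = trans (∑-distrib-- (unit k) (unit zero))
                 (trans (cong₂ _-_ (∑-unit-1 k) (∑-unit-1 {n} zero)) (ℚP.+-inverseʳ 1ℚ))

  ∑-Z : ∀ a → ∑[ j < n ] Z a j ≡ 0ℚ
  ∑-Z a = begin
    ∑[ j < n ] ∑[ i < m ] (a i * eᶠ (suc i) j) ≡⟨ ∑-comm (λ j i → a i * eᶠ (suc i) j) ⟩
    ∑[ i < m ] ∑[ j < n ] (a i * eᶠ (suc i) j) ≡⟨ sum-cong-≗ (λ i → sym (*-distribˡ-sum {n} (a i) (eᶠ (suc i)))) ⟩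
    ∑[ i < m ] (a i * ∑[ j < n ] eᶠ (suc i) j) ≡⟨ sum-cong-≗ (λ i → trans (cong (a i *_) (∑-eᶠ (suc i))) (ℚP.*-zeroʳ (a i))) ⟩
    ∑[ i < m ] 0ℚ                              ≡⟨ sum-replicate-zero m ⟩
    0ℚ                                         ∎
    where open ≡-Reasoning

  sum-zero⇒Z : ∀ y → ∑[ j < n ] y j ≡ 0ℚ → y ≗ Z (y ∘ suc)
  sum-zero⇒Z y ∑y≡0 zero = begin
    y zero                               ≡⟨ solve 2 (λ a s → a := s :* (con 0ℚ :- con 1ℚ) :+ (a :+ s)) refl (y zero) tail ⟩
    tail * (0ℚ - 1ℚ) + (y zero + tail)   ≡⟨ cong (_+_ (tail * (0ℚ - 1ℚ))) ∑y≡0 ⟩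
    tail * (0ℚ - 1ℚ) + 0ℚ                ≡⟨ ℚP.+-identityʳ (tail * (0ℚ - 1ℚ)) ⟩
    tail * (0ℚ - 1ℚ)                     ≡⟨ *-distribʳ-sum {m} (0ℚ - 1ℚ) (y ∘ suc) ⟩
    ∑[ i < m ] (y (suc i) * (0ℚ - 1ℚ))   ∎
    where
    open ≡-Reasoning
    tail = ∑[ i < m ] y (suc i)
  sum-zero⇒Z y ∑y≡0 (suc j) = sym (Z-coordinate (y ∘ suc) j)

  restrict : (ℕ → ℚ) → Fin m → ℚ
  restrict a i = a (suc (toℕ i))

  lin-e : ∀ a → lin n a (λ v → e n (+ v)) ≗ Z (restrict a)
  lin-e a j = trans (sumTo-∑ m (λ v → a v * e n (+ v) j))
                    (sum-cong-≗ (λ i → cong (restrict a i *_) (e-eᶠ (suc i) j)))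

  lin-ε : ∀ a → lin n a (λ v → ε n d (+ v)) ≗ Δ (ι d) φ (Z (restrict a))
  lin-ε a j = begin
    lin n a (λ v → ε n d (+ v)) j
      ≡⟨ sumTo-∑ m (λ v → a v * ε n d (+ v) j) ⟩
    ∑[ i < m ] (restrict a i * ε n d (+ toℕ (suc i)) j)
      ≡⟨ sum-cong-≗ (λ i → cong (restrict a i *_) (ε-Δ (suc i) j)) ⟩
    ∑[ i < m ] (restrict a i * Δ (ι d) φ (eᶠ (suc i)) j)
      ≡⟨ sum-cong-≗ (λ i → IsLinear.·-hom Δ-lin (restrict a i) (eᶠ (suc i)) j) ⟨
    ∑[ i < m ] Δ (ι d) φ (restrict a i · eᶠ (suc i)) j
      ≡⟨ sum-hom Δ-lin (λ i → restrict a i · eᶠ (suc i)) j ⟨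
    Δ (ι d) φ (Z (restrict a)) j ∎
    where
    open ≡-Reasoning
    Δ-lin = Δ-linear (ι d) φ-linear

module EpsilonBasis (m : ℕ) (d : ℤ) (2≤∣d∣ : 2 ℕ.≤ ∣ d ∣) where

  open GroupAlgebra m d
  open Residues n using ([_]; []-toℕ; μ)
  open Invertible φ-linear φ-periodic (ι d) (powers-distinct d 2≤∣d∣ (EventuallyPeriodic.I<J φ-periodic))

  ε-combination : (ℕ → ℚ) → Elt n
  ε-combination a = lin n a (λ v → ε n d (+ v))

  -- Summing (d − φ) y over all coordinates gives (d − 1) Σ y, and d ≠ 1;
  -- so if (d − φ) y has coefficient sum 0, then so has y.
  ∑-Δ : ∀ y → ∑[ j < n ] Δ (ι d) φ y j ≡ 0ℚ → ∑[ j < n ] y j ≡ 0ℚ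
  ∑-Δ y ∑Δy≡0 = *-cancel-nonzero (ι d ^ 1 - ι d ^ 0) (∑[ j < n ] y j) (powers-distinct d 2≤∣d∣ {0} {1} ℕ.z<s) (begin
    (ι d ^ 1 - ι d ^ 0) * ∑[ j < n ] y j
      ≡⟨ solve 2 (λ δ s → (δ :* con 1ℚ :- con 1ℚ) :* s := δ :* s :- s) refl (ι d) (∑[ j < n ] y j) ⟩
    ι d * ∑[ j < n ] y j - ∑[ j < n ] y j
      ≡⟨ cong₂ _-_ (*-distribˡ-sum {n} (ι d) y) (sym (∑-push (μ d) y)) ⟩
    ∑[ j < n ] (ι d * y j) - ∑[ j < n ] φ y j
      ≡⟨ ∑-distrib-- (λ j → ι d * y j) (φ y) ⟨
    ∑[ j < n ] Δ (ι d) φ y j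
      ≡⟨ ∑Δy≡0 ⟩
    0ℚ ∎)
    where open ≡-Reasoning

  -- Every sum-zero vector w is Σ β_v ε_v: take y = (d − φ)⁻¹ w, which has
  -- coefficient sum 0, so y = Σ y_v e_v and w = (d − φ) y = Σ y_v ε_v.
  ε-expansion : ∀ w → ∑[ j < n ] w j ≡ 0ℚ → ∃ λ β → ε-combination β ≗ w
  ε-expansion w ∑w≡0 = β , λ j → begin
      ε-combination β j             ≡⟨ lin-ε β j ⟩
      Δ (ι d) φ (Z (restrict β)) j  ≡⟨ IsLinear.cong-≗ Δ-lin (Z-cong (λ i → cong y ([]-toℕ (suc i)))) j ⟩
      Δ (ι d) φ (Z (y ∘ suc)) j     ≡⟨ IsLinear.cong-≗ Δ-lin (sum-zero⇒Z y ∑y≡0) j ⟨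
      Δ (ι d) φ y j                 ≡⟨ Δy≗w j ⟩
      w j                           ∎
    where
    open ≡-Reasoning
    Δ-lin : IsLinear (Δ (ι d) φ)
    Δ-lin = Δ-linear (ι d) φ-linear
    y : Elt n
    y = proj₁ (Δ-surjective w)
    Δy≗w : Δ (ι d) φ y ≗ w
    Δy≗w = proj₂ (Δ-surjective w)
    ∑y≡0 : ∑[ j < n ] y j ≡ 0ℚ
    ∑y≡0 = ∑-Δ y (trans (sum-cong-≗ Δy≗w) ∑w≡0)
    β : ℕ → ℚ
    β v = y [ + v ]

  -- The ε-coordinates are unique, since d − φ and a ↦ Σ a_v e_v are injective.
  ε-unique : ∀ a b → ε-combination a ≗ ε-combination b → ∀ v → 1 ℕ.≤ v → v ℕ.≤ m → a v ≡ b v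
  ε-unique a b a≗b (suc v) _ v<m = begin
      a (suc v)                ≡⟨ cong a (cong suc (FinP.toℕ-fromℕ< v<m)) ⟨
      restrict a i             ≡⟨ Z-coordinate (restrict a) i ⟨
      Z (restrict a) (suc i)   ≡⟨ Za≗Zb (suc i) ⟩
      Z (restrict b) (suc i)   ≡⟨ Z-coordinate (restrict b) i ⟩
      restrict b i             ≡⟨ cong b (cong suc (FinP.toℕ-fromℕ< v<m)) ⟩
      b (suc v)                ∎
    where
    open ≡-Reasoning
    i = Fin.fromℕ< v<m
    Za≗Zb : Z (restrict a) ≗ Z (restrict b)
    Za≗Zb = Δ-injective (λ j → trans (sym (lin-ε a j)) (trans (a≗b j) (lin-ε b j)))

-- "m is the least positive number with property P"; IsOrderΣ and
-- IsLeastDenom of Defs are both of this form.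
Least : (ℕ → Set) → ℕ → Set
Least P m = (0 ℕ.< m) × P m × (∀ k → 0 ℕ.< k → k ℕ.< m → ¬ P k)

least-⇔ : ∀ {P Q : ℕ → Set} → (∀ k → P k ⇔ Q k) → ∀ m → Least P m ⇔ Least Q m
least-⇔ P⇔Q m = mk⇔
  (λ (0<m , Pm , minimal) → 0<m , Equivalence.to (P⇔Q m) Pm , λ k 0<k k<m Qk → minimal k 0<k k<m (Equivalence.from (P⇔Q k) Qk))
  (λ (0<m , Qm , minimal) → 0<m , Equivalence.from (P⇔Q m) Qm , λ k 0<k k<m Pk → minimal k 0<k k<m (Equivalence.to (P⇔Q k) Pk))

module ReducedCoordinates (m : ℕ) (d : ℤ) (2≤∣d∣ : 2 ℕ.≤ ∣ d ∣) (c : ℕ → ℤ) where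

  open GroupAlgebra m d
  open EpsilonBasis m d 2≤∣d∣

  ∑-zElt : ∑[ j < n ] zElt n c j ≡ 0ℚ
  ∑-zElt = trans (sum-cong-≗ (lin-e (λ v → ι (c v)))) (∑-Z (restrict (λ v → ι (c v))))

  β : ℕ → ℚ
  β = proj₁ (ε-expansion (zElt n c) ∑-zElt)

  zElt≗β : ε-combination β ≗ zElt n c
  zElt≗β = proj₂ (ε-expansion (zElt n c) ∑-zElt)

  κ : ℕ → ℤ
  κ v = ⌊ β v ⌋

  α : ℕ → ℚ
  α v = frac (β v)

  α-range : ∀ v → 1 ℕ.≤ v → v ℕ.≤ n ∸ 1 → (0ℚ ≤ α v) × (α v < 1ℚ)
  α-range v _ _ = frac-nonneg (β v) , frac<1 (β v)

  α-represents : InE n d (diff (zElt n c) (ε-combination α))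
  α-represents = κ , λ j → begin
    zElt n c j - ε-combination α j            ≡⟨ cong (_- ε-combination α j) (zElt≗β j) ⟨
    ε-combination β j - ε-combination α j     ≡⟨ lin-sub n β α (λ v → ε n d (+ v)) j ⟩
    lin n (λ v → β v - α v) (λ v → ε n d (+ v)) j
      ≡⟨ lin-cong n (λ v → ε n d (+ v)) (λ v _ _ → β-α v) j ⟩
    ε-combination (λ v → ι (κ v)) j ∎
    where
    open ≡-Reasoning
    β-α : ∀ v → β v - α v ≡ ι (κ v)
    β-α v = trans (cong (_- α v) (sym (⌊⌋+frac (β v))))
                  (solve 2 (λ a b → (a :+ b) :- b := a) refl (ι (κ v)) (α v))

  kβ-split : ∀ k v → ι (+ k) * β v ≡ ι (+ k) * α v + ι (+ k ℤ.* κ v)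
  kβ-split k v = begin
    ι (+ k) * β v                          ≡⟨ cong (ι (+ k) *_) (⌊⌋+frac (β v)) ⟨
    ι (+ k) * (ι (κ v) + α v)
      ≡⟨ solve 3 (λ q f a → q :* (f :+ a) := q :* a :+ q :* f) refl (ι (+ k)) (ι (κ v)) (α v) ⟩
    ι (+ k) * α v + ι (+ k) * ι (κ v)      ≡⟨ cong (_+_ (ι (+ k) * α v)) (ι-* (+ k) (κ v)) ⟨
    ι (+ k) * α v + ι (+ k ℤ.* κ v)        ∎
    where open ≡-Reasoning

  scaled : ∀ k j → scale (ι (+ k)) (zElt n c) j ≡ ε-combination (λ v → ι (+ k) * β v) j
  scaled k j = trans (cong (ι (+ k) *_) (sym (zElt≗β j))) (lin-scale n (ι (+ k)) β (λ v → ε n d (+ v)) j)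

  killed⇔integral : ∀ k → InE n d (scale (ι (+ k)) (zElt n c)) ⇔ AllInt n α k
  killed⇔integral k = mk⇔ to from
    where
    -- If k Σ c_v e_v = Σ K_v ε_v, uniqueness of ε-coordinates gives K_v = k β_v,
    -- so k α_v = K_v − k κ_v.
    to : InE n d (scale (ι (+ k)) (zElt n c)) → AllInt n α k
    to (K , kzElt≡K) v 1≤v v≤m = K v ℤ.- + k ℤ.* κ v , (begin
      ι (+ k) * α v                                     ≡⟨ solve 2 (λ a b → a := (a :+ b) :- b) refl (ι (+ k) * α v) (ι (+ k ℤ.* κ v)) ⟩
      (ι (+ k) * α v + ι (+ k ℤ.* κ v)) - ι (+ k ℤ.* κ v) ≡⟨ cong (_- ι (+ k ℤ.* κ v)) (trans (sym (kβ-split k v)) (sym K≡kβ)) ⟩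
      ι (K v) - ι (+ k ℤ.* κ v)                         ≡⟨ ι-- (K v) (+ k ℤ.* κ v) ⟨
      ι (K v ℤ.- + k ℤ.* κ v)                           ∎)
      where
      open ≡-Reasoning
      K≡kβ : ι (K v) ≡ ι (+ k) * β v
      K≡kβ = ε-unique (λ v → ι (K v)) (λ v → ι (+ k) * β v)
               (λ j → trans (sym (kzElt≡K j)) (scaled k j)) v 1≤v v≤m
    -- If all k α_v are integers, so are all k β_v, and ⌊k β_v⌋ are exact
    -- ε-coordinates of k Σ c_v e_v.
    from : AllInt n α k → InE n d (scale (ι (+ k)) (zElt n c))
    from kα-integral = (λ v → ⌊ ι (+ k) * β v ⌋) , λ j →
      trans (scaled k j) (lin-cong n {λ v → ι (+ k) * β v} {λ v → ι ⌊ ι (+ k) * β v ⌋} (λ v → ε n d (+ v))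
        (λ v 1≤v v≤m → sym (⌊⌋-integer (ι (+ k) * β v) (kβ-integral v 1≤v v≤m))) j)
      where
      kβ-integral : ∀ v → 1 ℕ.≤ v → v ℕ.≤ n ∸ 1 → IsInt (ι (+ k) * β v)
      kβ-integral v 1≤v v≤m = z ℤ.+ + k ℤ.* κ v ,
          trans (kβ-split k v) (trans (cong (_+ ι (+ k ℤ.* κ v)) kα≡z) (sym (ι-+ z (+ k ℤ.* κ v))))
        where
        z : ℤ
        z = proj₁ (kα-integral v 1≤v v≤m)
        kα≡z : ι (+ k) * α v ≡ ι z
        kα≡z = proj₂ (kα-integral v 1≤v v≤m)

lemma2p8 : (n : ℕ) → .{{_ : NonZero n}} → (d : ℤ) → 2 ℕ.≤ ∣ d ∣ →
    (c : ℕ → ℤ) →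
    ∃ λ (α : ℕ → ℚ) →
      (∀ v → 1 ℕ.≤ v → v ℕ.≤ n ∸ 1 → (0ℚ ≤ α v) × (α v < 1ℚ)) ×
      InE n d (diff (zElt n c) (lin n α (λ v → ε n d (+ v)))) ×
      (∀ m → IsOrderΣ n d c m ⇔ IsLeastDenom n α m)
lemma2p8 (suc m) d 2≤∣d∣ c = α , α-range , α-represents , least-⇔ killed⇔integral
  where open ReducedCoordinates m d 2≤∣d∣ c
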